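{- Let $(\alpha_n)_{n\ge0}$ be a sequence of complex numbers and $A_n(x)=\sum_{\nu=0}^{n}\binom{n}{\nu}\alpha_{n-\nu}x^\nu$. For integers $r,s\ge0$ let $\alpha_{r,s}=\sum_{\nu=0}^{r}\binom{r}{\nu}\alpha_{s+\nu}$. If $A_m(1-x)=(-1)^mA_m(x)$ for all $m\ge0$, then for all $r,s\ge0$, $(-1)^r\alpha_{r,s}=(-1)^s\alpha_{s,r}$.
   Context: $\alpha_0=0$ is allowed. -}

module Defs where

open import Level using (_⊔_)
open import Data.Nat using (ℕ; zero; suc; _∸_) renaming (_+_ to _+ℕ_)
open import Data.Nat.Combinatorics using (_C_)
open import Data.Sum using (_⊎_)
open import Relation.Binary.PropositionalEquality using (_≡_)
open import Algebra.Bundles using (CommutativeRing; Semiring)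

-- Everything is stated over a commutative ring R (standing in for ℂ).
module Over {c ℓ} (R : CommutativeRing c ℓ) where
  open CommutativeRing R
  open import Algebra.Definitions.RawMonoid +-rawMonoid using (_×_)
  open import Algebra.Definitions.RawSemiring (Semiring.rawSemiring semiring) using (_^_)

  sign : ℕ → Carrier
  sign m = (- 1#) ^ m

  Σ≤ : ℕ → (ℕ → Carrier) → Carrier
  Σ≤ zero    f = f 0
  Σ≤ (suc n) f = Σ≤ n f + f (suc n)

  A : (ℕ → Carrier) → ℕ → Carrier → Carrier
  A α n x = Σ≤ n (λ ν → (n C ν) × (α (n ∸ ν) * (x ^ ν)))

  αrs : (ℕ → Carrier) → ℕ → ℕ → Carrier
  αrs α r s = Σ≤ r (λ ν → (r C ν) × α (s +ℕ ν))

  CharZero : Set ℓ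
  CharZero = ∀ n → n × 1# ≈ 0# → n ≡ 0

  NoZeroDivisors : Set (c ⊔ ℓ)
  NoZeroDivisors = ∀ x y → x * y ≈ 0# → x ≈ 0# ⊎ y ≈ 0#

{-# OPTIONS --safe #-}
-- Twist the array by signs, T r s = (-1)^r α_{r,s}.  Pascal's rule
-- α_{r+1,s} = α_{r,s} + α_{r,s+1} becomes T r s + T (r+1) s + T r (s+1) = 0,
-- a relation invariant under transposing T and determining T from its column
-- s = 0.  So T is symmetric as soon as T r 0 = T 0 r, i.e. α_{r,0} = (-1)^r α_r,
-- which is the hypothesis at x = 0: A_r(1) = α_{r,0} and A_r(0) = α_r.
module Submission where

open import Defs
open import Data.Nat using (ℕ; zero; suc; _∸_; _≤_; z≤n) renaming (_+_ to _+ℕ_)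
import Data.Nat.Properties as ℕ
open import Data.Nat.Combinatorics using (_C_; nCk+nC[k+1]≡[n+1]C[k+1]; k>n⇒nCk≡0; nCk≡nC[n∸k])
open import Algebra.Bundles using (CommutativeRing; Semiring)
import Relation.Binary.PropositionalEquality as ≡

module _ {c ℓ} (R : CommutativeRing c ℓ) where
  open CommutativeRing R
  open Over R
  open import Algebra.Definitions.RawMonoid +-rawMonoid using (_×_)
  open import Algebra.Definitions.RawSemiring (Semiring.rawSemiring semiring) using (_^_)
  open import Algebra.Properties.Monoid.Mult +-monoid using (×-congʳ; ×-congˡ; ×-homo-+)
  open import Algebra.Properties.Semiring.Exp semiring using (^-congˡ)
  open import Algebra.Properties.Ring ring using (-1*x≈-x; -‿involutive; +-inverseʳ-unique)
  open import Relation.Binary.Reasoning.Setoid setoid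
  open import Algebra.Properties.CommutativeSemigroup +-commutativeSemigroup
    using (xy∙z≈xz∙y; x∙yz≈xz∙y) renaming (interchange to +-interchange)
  open import Algebra.Properties.CommutativeSemigroup *-commutativeSemigroup
    using () renaming (interchange to *-interchange)

  Σ≤-cong : ∀ n {f g : ℕ → Carrier} → (∀ k → k ≤ n → f k ≈ g k) → Σ≤ n f ≈ Σ≤ n g
  Σ≤-cong zero    f≈g = f≈g 0 z≤n
  Σ≤-cong (suc n) f≈g =
    +-cong (Σ≤-cong n (λ k k≤n → f≈g k (ℕ.m≤n⇒m≤1+n k≤n))) (f≈g (suc n) ℕ.≤-refl)

  Σ≤-distrib-+ : ∀ n (f g : ℕ → Carrier) → Σ≤ n (λ k → f k + g k) ≈ Σ≤ n f + Σ≤ n g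
  Σ≤-distrib-+ zero    f g = refl
  Σ≤-distrib-+ (suc n) f g = trans (+-congʳ (Σ≤-distrib-+ n f g))
    (+-interchange (Σ≤ n f) (Σ≤ n g) (f (suc n)) (g (suc n)))

  Σ≤-unfoldˡ : ∀ n (f : ℕ → Carrier) → Σ≤ (suc n) f ≈ f 0 + Σ≤ n (λ k → f (suc k))
  Σ≤-unfoldˡ zero    f = refl
  Σ≤-unfoldˡ (suc n) f = trans (+-congʳ (Σ≤-unfoldˡ n f)) (+-assoc _ _ _)

  Σ≤-reverse : ∀ n (f : ℕ → Carrier) → Σ≤ n f ≈ Σ≤ n (λ k → f (n ∸ k))
  Σ≤-reverse zero    f = refl
  Σ≤-reverse (suc n) f = begin
    Σ≤ n f + f (suc n)                  ≈⟨ +-comm _ _ ⟩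
    f (suc n) + Σ≤ n f                  ≈⟨ +-congˡ (Σ≤-reverse n f) ⟩
    f (suc n) + Σ≤ n (λ k → f (n ∸ k))  ≈⟨ Σ≤-unfoldˡ n (λ k → f (suc n ∸ k)) ⟨
    Σ≤ (suc n) (λ k → f (suc n ∸ k))    ∎

  Σ≤-head : ∀ n (f : ℕ → Carrier) → (∀ k → f (suc k) ≈ 0#) → Σ≤ n f ≈ f 0
  Σ≤-head zero    f tail≈0 = refl
  Σ≤-head (suc n) f tail≈0 = trans (+-cong (Σ≤-head n f tail≈0) (tail≈0 n)) (+-identityʳ _)

  ×-zeroʳ : ∀ n → n × 0# ≈ 0#
  ×-zeroʳ zero    = refl
  ×-zeroʳ (suc n) = trans (+-identityˡ _) (×-zeroʳ n)

  1^n≈1 : ∀ n → 1# ^ n ≈ 1#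
  1^n≈1 zero    = refl
  1^n≈1 (suc n) = trans (*-identityˡ _) (1^n≈1 n)

  sign-cancel : ∀ n → sign n + sign (suc n) ≈ 0#
  sign-cancel n = trans (+-congˡ (-1*x≈-x (sign n))) (-‿inverseʳ (sign n))

  sign*sign≈1 : ∀ n → sign n * sign n ≈ 1#
  sign*sign≈1 zero    = *-identityˡ 1#
  sign*sign≈1 (suc n) = begin
    (- 1# * sign n) * (- 1# * sign n)  ≈⟨ *-interchange (- 1#) (sign n) (- 1#) (sign n) ⟩
    (- 1# * - 1#) * (sign n * sign n)  ≈⟨ *-cong (trans (-1*x≈-x (- 1#)) (-‿involutive 1#)) (sign*sign≈1 n) ⟩
    1# * 1#                            ≈⟨ *-identityˡ 1# ⟩
    1#                                 ∎

  ThreeTermNull : (ℕ → ℕ → Carrier) → Set ℓ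
  ThreeTermNull T = ∀ r s → T r s + T (suc r) s + T r (suc s) ≈ 0#

  threeTermNull-transpose : ∀ {T} → ThreeTermNull T → ThreeTermNull (λ r s → T s r)
  threeTermNull-transpose {T} null r s = trans
    (xy∙z≈xz∙y (T s r) (T s (suc r)) (T (suc s) r))
    (null s r)

  threeTermNull-unique : ∀ {U V} → ThreeTermNull U → ThreeTermNull V →
    (∀ r → U r 0 ≈ V r 0) → ∀ s r → U r s ≈ V r s
  threeTermNull-unique nullU nullV U≈V zero    r = U≈V r
  threeTermNull-unique {U} {V} nullU nullV U≈V (suc s) r = begin
    U r (suc s)                ≈⟨ +-inverseʳ-unique _ _ (nullU r s) ⟩
    - (U r s + U (suc r) s)    ≈⟨ -‿cong (+-cong (IH r) (IH (suc r))) ⟩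
    - (V r s + V (suc r) s)    ≈⟨ +-inverseʳ-unique _ _ (nullV r s) ⟨
    V r (suc s)                ∎
    where
    IH : ∀ r → U r s ≈ V r s
    IH = threeTermNull-unique nullU nullV U≈V s

  signed-pascal-threeTermNull : (f : ℕ → ℕ → Carrier) →
    (∀ r s → f (suc r) s ≈ f r s + f r (suc s)) →
    ThreeTermNull (λ r s → sign r * f r s)
  signed-pascal-threeTermNull f pascal r s = begin
    sign r * f r s + sign (suc r) * f (suc r) s + sign r * f r (suc s)
      ≈⟨ xy∙z≈xz∙y _ _ _ ⟩
    sign r * f r s + sign r * f r (suc s) + sign (suc r) * f (suc r) s
      ≈⟨ +-congʳ (distribˡ _ _ _) ⟨
    sign r * (f r s + f r (suc s)) + sign (suc r) * f (suc r) s
      ≈⟨ +-congʳ (*-congˡ (pascal r s)) ⟨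
    sign r * f (suc r) s + sign (suc r) * f (suc r) s
      ≈⟨ distribʳ _ _ _ ⟨
    (sign r + sign (suc r)) * f (suc r) s
      ≈⟨ *-congʳ (sign-cancel r) ⟩
    0# * f (suc r) s
      ≈⟨ zeroˡ _ ⟩
    0# ∎

  A-congʳ : ∀ α m {x y} → x ≈ y → A α m x ≈ A α m y
  A-congʳ α m x≈y = Σ≤-cong m (λ k _ → ×-congʳ (m C k) (*-congˡ (^-congˡ k x≈y)))

  A-at-0 : ∀ α m → A α m 0# ≈ α m
  A-at-0 α m =
    trans (Σ≤-head m _ (λ k → trans (×-congʳ (m C suc k) (trans (*-congˡ (zeroˡ _)) (zeroʳ _)))
                                    (×-zeroʳ (m C suc k))))
          (trans (+-identityʳ _) (*-identityʳ _))

  A-at-1 : ∀ α m → A α m 1# ≈ αrs α m 0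
  A-at-1 α m = begin
    A α m 1#
      ≈⟨ Σ≤-cong m (λ k _ → ×-congʳ (m C k) (trans (*-congˡ (1^n≈1 k)) (*-identityʳ _))) ⟩
    Σ≤ m (λ k → (m C k) × α (m ∸ k))
      ≈⟨ Σ≤-reverse m _ ⟩
    Σ≤ m (λ k → (m C (m ∸ k)) × α (m ∸ (m ∸ k)))
      ≈⟨ Σ≤-cong m (λ k k≤m → reflexive (≡.cong₂ (λ i j → i × α j)
                                 (≡.sym (nCk≡nC[n∸k] k≤m)) (ℕ.m∸[m∸n]≡n k≤m))) ⟩
    αrs α m 0 ∎

  αrs-zero : ∀ α r → αrs α 0 r ≈ α r
  αrs-zero α r = trans (+-identityʳ _) (reflexive (≡.cong α (ℕ.+-identityʳ r)))

  αrs-pascal : ∀ α r s → αrs α (suc r) s ≈ αrs α r s + αrs α r (suc s)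
  αrs-pascal α r s = begin
    αrs α (suc r) s
      ≈⟨ Σ≤-unfoldˡ r _ ⟩
    f 0 + Σ≤ r (λ k → (suc r C suc k) × α (s +ℕ suc k))
      ≈⟨ +-congˡ (Σ≤-cong r (λ k _ → ×-congˡ (≡.sym (nCk+nC[k+1]≡[n+1]C[k+1] r k)))) ⟩
    f 0 + Σ≤ r (λ k → (r C k +ℕ r C suc k) × α (s +ℕ suc k))
      ≈⟨ +-congˡ (Σ≤-cong r (λ k _ → ×-homo-+ _ (r C k) (r C suc k))) ⟩
    f 0 + Σ≤ r (λ k → (r C k) × α (s +ℕ suc k) + f (suc k))
      ≈⟨ +-congˡ (Σ≤-distrib-+ r _ _) ⟩
    f 0 + (shifted + Σ≤ r (λ k → f (suc k)))
      ≈⟨ x∙yz≈xz∙y (f 0) shifted (Σ≤ r (λ k → f (suc k))) ⟩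
    (f 0 + Σ≤ r (λ k → f (suc k))) + shifted
      ≈⟨ +-congʳ (Σ≤-unfoldˡ r f) ⟨
    (αrs α r s + f (suc r)) + shifted
      ≈⟨ +-congʳ (+-congˡ (×-congˡ (k>n⇒nCk≡0 (ℕ.n<1+n r)))) ⟩
    (αrs α r s + 0#) + shifted
      ≈⟨ +-congʳ (+-identityʳ _) ⟩
    αrs α r s + shifted
      ≈⟨ +-congˡ (Σ≤-cong r (λ k _ → reflexive (≡.cong (λ m → (r C k) × α m) (ℕ.+-suc s k)))) ⟩
    αrs α r s + αrs α r (suc s) ∎
    where
    f : ℕ → Carrier
    f k = (r C k) × α (s +ℕ k)
    shifted : Carrier
    shifted = Σ≤ r (λ k → (r C k) × α (s +ℕ suc k))

corollary3p2 : ∀ {c ℓ} (R : CommutativeRing c ℓ) →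
    let open CommutativeRing R
        open Over R
    in
    CharZero → NoZeroDivisors →
    (α : ℕ → Carrier) →
    (∀ (m : ℕ) (x : Carrier) → A α m (1# - x) ≈ sign m * A α m x) →
    ∀ (r s : ℕ) → sign r * αrs α r s ≈ sign s * αrs α s r
corollary3p2 R _ _ α reflection r s =
  threeTermNull-unique R twisted (threeTermNull-transpose R twisted) boundary s r
  where
  open CommutativeRing R
  open Over R
  open import Relation.Binary.Reasoning.Setoid setoid
  open import Algebra.Properties.Ring ring using (-0#≈0#)

  twisted : ThreeTermNull R (λ r s → sign r * αrs α r s)
  twisted = signed-pascal-threeTermNull R (αrs α) (αrs-pascal R α)

  boundary : ∀ r → sign r * αrs α r 0 ≈ sign 0 * αrs α 0 r
  boundary r = begin
    sign r * αrs α r 0              ≈⟨ *-congˡ (A-at-1 R α r) ⟨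
    sign r * A α r 1#               ≈⟨ *-congˡ (A-congʳ R α r (trans (+-congˡ -0#≈0#) (+-identityʳ 1#))) ⟨
    sign r * A α r (1# - 0#)        ≈⟨ *-congˡ (reflection r 0#) ⟩
    sign r * (sign r * A α r 0#)    ≈⟨ *-assoc _ _ _ ⟨
    (sign r * sign r) * A α r 0#    ≈⟨ *-cong (sign*sign≈1 R r) (trans (A-at-0 R α r) (sym (αrs-zero R α r))) ⟩
    1# * αrs α 0 r                  ∎
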